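{- Consider the equation \[ (a-c)^2(b^2+1) = (b-c)^2(a^2+1) \qquad (\star) \] and call a solution $(a,b,c)$ trivial if $|a|=|b|$ and nontrivial otherwise. (1) If $(a,b,c)=(a_1,b_1,c_1)$ is a real solution of $(\star)$, then so are $(a_1,b_1,-c_1^{ -1})$ (when $c_1\neq 0$), $(-a_1,-b_1,-c_1)$ and $(b_1,a_1,c_1)$. (2) $(\star)$ has no nontrivial integral solution $(a,b,c)$ with $a=0$ or $b=0$. (3) For every nontrivial integral solution $(a,b,c)=(a_1,b_1,c_1)$ of $(\star)$, there exists a square-free integer $d>1$ such that $a_1$ and $b_1$ are both $x$-components of integral solutions $(x,y)$ of $x^2-dy^2=-1$. -}

module Defs where

open import Level using (Level)
open import Algebra.Bundles using (CommutativeRing)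
open import Data.Nat as ℕ using (ℕ)
import Data.Nat.Divisibility as ℕD
open import Data.Integer as ℤ using (ℤ; +_; -_; ∣_∣)
open import Data.Product using (_×_; ∃)
open import Relation.Binary.PropositionalEquality using (_≡_)

module _ {c ℓ : Level} (R : CommutativeRing c ℓ) where
  open CommutativeRing R

  StarR : Carrier → Carrier → Carrier → Set ℓ
  StarR a b x = ((a - x) * (a - x)) * (b * b + 1#) ≈ ((b - x) * (b - x)) * (a * a + 1#)

StarZ : ℤ → ℤ → ℤ → Set
StarZ a b c = ((a ℤ.- c) ℤ.* (a ℤ.- c)) ℤ.* (b ℤ.* b ℤ.+ + 1)
            ≡ ((b ℤ.- c) ℤ.* (b ℤ.- c)) ℤ.* (a ℤ.* a ℤ.+ + 1)

Trivial : ℤ → ℤ → ℤ → Set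
Trivial a b c = ∣ a ∣ ≡ ∣ b ∣

SquareFree : ℕ → Set
SquareFree d = ∀ (k : ℕ) → (k ℕ.* k) ℕD.∣ d → k ≡ 1

PellXComponent : ℕ → ℤ → Set
PellXComponent d x = ∃ λ (y : ℤ) → x ℤ.* x ℤ.- (+ d) ℤ.* (y ℤ.* y) ≡ - (+ 1)

{-# OPTIONS --safe #-}
-- The identity (a x + 1)² + (a - x)² = (a² + 1)(x² + 1) rewrites (⋆) as
-- (a x + 1)² (b² + 1) = (b x + 1)² (a² + 1). If x u = 1 then a + u = u (a x + 1),
-- so (⋆) at -u is the rewritten (⋆) at x multiplied by u²: this is the symmetry c ↦ -c⁻¹.
--
-- Over ℤ, (⋆) factors as (a - b) Q(a, b, c) = 0 with Q = (a + b)(1 - c²) + 2c (a b - 1),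
-- and completing the square in c gives ((a + b) c - (a b - 1))² = (a² + 1)(b² + 1) - (a + b) Q.
-- So for a nontrivial solution (a² + 1)(b² + 1) is a square. Since n² + 1 is a square only
-- for n = 0, this settles (2). For (3), write a² + 1 = d y² with d square-free; then
-- d (b² + 1) is a square, so b² + 1 = d u², and d ≠ 1 because a ≠ 0.
module Submission where

open import Level using (Level)
open import Algebra.Bundles using (CommutativeRing)
open import Data.Nat as ℕ using (ℕ)
open import Data.Integer as ℤ using (ℤ; +_)
open import Data.Product using (_×_; ∃; _,_)
open import Data.Sum using (_⊎_; inj₁; inj₂)
open import Relation.Nullary using (¬_)
open import Relation.Nullary.Decidable using (decidable-stable)
open import Relation.Binary.PropositionalEquality using (_≡_)
open import Defs

import Algebra.Properties.Ring as RingProperties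
import Algebra.Solver.Ring.NaturalCoefficients.Default as NaturalCoefficientSolver
import Relation.Binary.Reasoning.Setoid as SetoidReasoning

module StarR-Properties {c ℓ : Level} (R : CommutativeRing c ℓ) where
  open CommutativeRing R
  open RingProperties ring using (-‿distribˡ-*; -‿distribʳ-*; -‿involutive; -‿+-comm; +-cancelʳ)
  open NaturalCoefficientSolver commutativeSemiring using (solve; _:=_; _:+_; _:*_; con)
  open SetoidReasoning setoid

  sq : Carrier → Carrier
  sq x = x * x

  sq-neg : ∀ x → sq (- x) ≈ sq x
  sq-neg x = begin
    - x * - x   ≈⟨ -‿distribˡ-* x (- x) ⟨
    - (x * - x) ≈⟨ -‿cong (-‿distribʳ-* x x) ⟨
    - - (x * x) ≈⟨ -‿involutive (x * x) ⟩
    x * x       ∎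

  -- The solver has only natural coefficients, so -x is first abstracted to a
  -- variable m and the relations m * m ≈ x * x and x + m ≈ 0 are used afterwards.
  brahmagupta-fibonacci : ∀ a x → sq (a * x + 1#) + sq (a - x) ≈ (sq a + 1#) * (sq x + 1#)
  brahmagupta-fibonacci a x = begin
    sq (a * x + 1#) + sq (a - x)                   ≈⟨ expand a x (- x) ⟩
    (sq a * sq x + 1# + sq a + sq (- x)) + (a + a) * (x - x)
      ≈⟨ +-cong (+-congˡ (sq-neg x)) (trans (*-congˡ (-‿inverseʳ x)) (zeroʳ (a + a))) ⟩
    (sq a * sq x + 1# + sq a + sq x) + 0#          ≈⟨ factor a x ⟩
    (sq a + 1#) * (sq x + 1#)                      ∎
    where
    expand : ∀ a x m → sq (a * x + 1#) + sq (a + m) ≈ (sq a * sq x + 1# + sq a + sq m) + (a + a) * (x + m)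
    expand = solve 3 (λ a x m → (a :* x :+ con 1) :* (a :* x :+ con 1) :+ (a :+ m) :* (a :+ m)
                              := (a :* a :* (x :* x) :+ con 1 :+ a :* a :+ m :* m) :+ (a :+ a) :* (x :+ m)) refl
    factor : ∀ a x → (sq a * sq x + 1# + sq a + sq x) + 0# ≈ (sq a + 1#) * (sq x + 1#)
    factor = solve 2 (λ a x → (a :* a :* (x :* x) :+ con 1 :+ a :* a :+ x :* x) :+ con 0
                            := (a :* a :+ con 1) :* (x :* x :+ con 1)) refl

  starR-conjugate : ∀ {a b x} → StarR R a b x →
                    sq (a * x + 1#) * (sq b + 1#) ≈ sq (b * x + 1#) * (sq a + 1#)
  starR-conjugate {a} {b} {x} star = +-cancelʳ (sq (a - x) * B) _ _ (begin
    sq (a * x + 1#) * B + sq (a - x) * B ≈⟨ distribʳ B _ _ ⟨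
    (sq (a * x + 1#) + sq (a - x)) * B   ≈⟨ *-congʳ (brahmagupta-fibonacci a x) ⟩
    (A * X) * B                          ≈⟨ swap A X B ⟩
    (B * X) * A                          ≈⟨ *-congʳ (brahmagupta-fibonacci b x) ⟨
    (sq (b * x + 1#) + sq (b - x)) * A   ≈⟨ distribʳ A _ _ ⟩
    sq (b * x + 1#) * A + sq (b - x) * A ≈⟨ +-congˡ star ⟨
    sq (b * x + 1#) * A + sq (a - x) * B ∎)
    where
    A B X : Carrier
    A = sq a + 1#
    B = sq b + 1#
    X = sq x + 1#
    swap : ∀ A X B → (A * X) * B ≈ (B * X) * A
    swap = solve 3 (λ A X B → (A :* X) :* B := (B :* X) :* A) refl

  a-[-u]≈u[ax+1] : ∀ a {x u} → x * u ≈ 1# → a - - u ≈ u * (a * x + 1#)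
  a-[-u]≈u[ax+1] a {x} {u} xu≈1 = begin
    a - - u         ≈⟨ +-congˡ (-‿involutive u) ⟩
    a + u           ≈⟨ +-congʳ (trans (*-congˡ xu≈1) (*-identityʳ a)) ⟨
    a * (x * u) + u ≈⟨ distribute u a x ⟨
    u * (a * x + 1#) ∎
    where
    distribute : ∀ u a x → u * (a * x + 1#) ≈ a * (x * u) + u
    distribute = solve 3 (λ u a x → u :* (a :* x :+ con 1) := a :* (x :* u) :+ u) refl

  starR-inverse : ∀ {a b x u} → StarR R a b x → x * u ≈ 1# → StarR R a b (- u)
  starR-inverse {a} {b} {x} {u} star xu≈1 = begin
    sq (a - - u) * B                ≈⟨ *-congʳ (*-cong (a-[-u]≈u[ax+1] a xu≈1) (a-[-u]≈u[ax+1] a xu≈1)) ⟩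
    sq (u * (a * x + 1#)) * B       ≈⟨ regroup u _ B ⟩
    sq u * (sq (a * x + 1#) * B)    ≈⟨ *-congˡ (starR-conjugate star) ⟩
    sq u * (sq (b * x + 1#) * A)    ≈⟨ regroup u _ A ⟨
    sq (u * (b * x + 1#)) * A       ≈⟨ *-congʳ (*-cong (a-[-u]≈u[ax+1] b xu≈1) (a-[-u]≈u[ax+1] b xu≈1)) ⟨
    sq (b - - u) * A                ∎
    where
    A B : Carrier
    A = sq a + 1#
    B = sq b + 1#
    regroup : ∀ u y B → sq (u * y) * B ≈ sq u * (sq y * B)
    regroup = solve 3 (λ u y B → ((u :* y) :* (u :* y)) :* B := (u :* u) :* ((y :* y) :* B)) refl

  starR-negate : ∀ {a b x} → StarR R a b x → StarR R (- a) (- b) (- x)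
  starR-negate {a} {b} {x} star = trans (negate a b) (trans star (sym (negate b a)))
    where
    negate : ∀ a b → sq (- a - - x) * (sq (- b) + 1#) ≈ sq (a - x) * (sq b + 1#)
    negate a b = *-cong (trans (*-cong (-‿+-comm a (- x)) (-‿+-comm a (- x))) (sq-neg (a - x)))
                        (+-congʳ (sq-neg b))

  starR-swap : ∀ {a b x} → StarR R a b x → StarR R b a x
  starR-swap = sym

module Squares where

  open import Data.Nat
  open import Data.Nat.Properties
  open import Data.Nat.Divisibility
  open import Data.Nat.DivMod using (m/n*n≡m)
  open import Data.Nat.GCD using (gcd; gcd[m,n]∣m; gcd[m,n]∣n; gcd[m,n]≢0)
  open import Data.Nat.Coprimality using (Coprime; coprime-/gcd; coprime-divisor)
  open import Data.Nat.Induction using (<-rec)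
  open import Data.Nat.Tactic.RingSolver using (solve-∀)
  open import Data.Product using (∃; ∃₂; _×_; _,_)
  open import Data.Sum using (_⊎_; inj₁; inj₂)
  open import Relation.Nullary using (yes; no; contradiction)
  open import Relation.Nullary.Decidable using (_×-dec_)
  open import Relation.Binary.PropositionalEquality

  IsSquare : ℕ → Set
  IsSquare n = ∃ λ t → n ≡ t * t

  suc[n*n]-square⇒n≡0 : ∀ n → IsSquare (suc (n * n)) → n ≡ 0
  suc[n*n]-square⇒n≡0 zero    _        = refl
  suc[n*n]-square⇒n≡0 n@(suc _) (t , eq) with t ≤? n
  ... | yes t≤n = contradiction (subst (_≤ n * n) (sym eq) (*-mono-≤ t≤n t≤n)) 1+n≰n
  ... | no  t≰n =
    contradiction (subst (suc n * suc n ≤_) (sym eq) (*-mono-≤ n<t n<t)) (<⇒≱ (s≤s n*n<n+n*suc[n]))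
    where
    n<t : n < t
    n<t = ≰⇒> t≰n
    n*n<n+n*suc[n] : n * n < n + n * suc n
    n*n<n+n*suc[n] = ≤-<-trans (*-monoʳ-≤ n (n≤1+n n)) (m<n+m (n * suc n) z<s)

  gcd-decomposition : ∀ m n → m ≢ 0 →
                      ∃₂ λ q r → ∃ λ g → NonZero g × Coprime q r × m ≡ q * g × n ≡ r * g
  gcd-decomposition m n m≢0 =
    m / g , n / g , g , g≢0 , coprime-/gcd m n
          , sym (m/n*n≡m (gcd[m,n]∣m m n)) , sym (m/n*n≡m (gcd[m,n]∣n m n))
    where
    g : ℕ
    g = gcd m n
    instance
      g≢0 : NonZero g
      g≢0 = ≢-nonZero (gcd[m,n]≢0 m n (inj₁ m≢0))

  coprime-square-cancel : ∀ {q r m} → Coprime q r → q * q * m ≡ r * r → m ≡ r * r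
  coprime-square-cancel {q} {r} {m} q⊥r qqm≡rr with q⊥r (∣-refl , coprime-divisor q⊥r q∣rr)
    where
    q∣rr : q ∣ r * r
    q∣rr = subst (q ∣_) qqm≡rr (∣m⇒∣m*n m (∣m⇒∣m*n q ∣-refl))
  ... | refl = trans (sym (+-identityʳ m)) qqm≡rr

  k*k*m-square⇒m-square : ∀ k m → k ≢ 0 → IsSquare (k * k * m) → IsSquare m
  k*k*m-square⇒m-square k m k≢0 (t , eq) with gcd-decomposition k t k≢0
  ... | q , r , g , g≢0 , q⊥r , refl , refl = r , coprime-square-cancel q⊥r qqm≡rr
    where
    instance _ = g≢0
    regroup : ∀ q m g → q * q * m * (g * g) ≡ q * g * (q * g) * m
    regroup = solve-∀
    regroup′ : ∀ r g → r * g * (r * g) ≡ r * r * (g * g)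
    regroup′ = solve-∀
    qqm≡rr : q * q * m ≡ r * r
    qqm≡rr = *-cancelʳ-≡ _ _ (g * g) {{m*n≢0 g g}} (trans (regroup q m g) (trans eq (regroup′ r g)))

  squareFree⇒≢0 : ∀ {d} → SquareFree d → d ≢ 0
  squareFree⇒≢0 sf refl with sf 2 (divides 0 refl)
  ... | ()

  -- q is coprime to r and divides r² g, hence divides g; so q² divides q g and square-freeness forces q = 1.
  squareFree-coprime-cancel : ∀ {q g r m} → SquareFree (q * g) → Coprime q r →
                              q * m ≡ r * (r * g) → m ≡ q * g * (r * r)
  squareFree-coprime-cancel {q} {g} {r} {m} sf q⊥r qm≡rrg with q∣g
    where
    q∣g : q ∣ g
    q∣g = coprime-divisor q⊥r (coprime-divisor q⊥r (subst (q ∣_) qm≡rrg (m∣m*n m)))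
  ... | divides s refl with sf q (divides s (regroup q s))
    where
    regroup : ∀ q s → q * (s * q) ≡ s * (q * q)
    regroup = solve-∀
  ... | refl = trans (sym (+-identityʳ m)) (trans qm≡rrg (regroup r s))
    where
    regroup : ∀ r s → r * (r * (s * 1)) ≡ 1 * (s * 1) * (r * r)
    regroup = solve-∀

  d*m-square⇒m≡d*square : ∀ {d m} → SquareFree d → IsSquare (d * m) → ∃ λ u → m ≡ d * (u * u)
  d*m-square⇒m≡d*square {d} {m} sf (t , eq) with gcd-decomposition d t (squareFree⇒≢0 sf)
  ... | q , r , g , g≢0 , q⊥r , refl , refl = r , squareFree-coprime-cancel sf q⊥r qm≡rrg
    where
    instance _ = g≢0
    regroup : ∀ q m g → q * m * g ≡ q * g * m
    regroup = solve-∀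
    regroup′ : ∀ r g → r * g * (r * g) ≡ r * (r * g) * g
    regroup′ = solve-∀
    qm≡rrg : q * m ≡ r * (r * g)
    qm≡rrg = *-cancelʳ-≡ _ _ g (trans (regroup q m g) (trans eq (regroup′ r g)))

  squareFree⊎square-factor : ∀ n → n ≢ 0 → SquareFree n ⊎ ∃ λ k → 1 < k × k * k ∣ n
  squareFree⊎square-factor n n≢0 with anyUpTo? (λ k → (1 <? k) ×-dec (k * k ∣? n)) (suc n)
  ... | yes (k , _ , 1<k , kk∣n) = inj₂ (k , 1<k , kk∣n)
  ... | no none = inj₁ squareFree
    where
    instance _ = ≢-nonZero n≢0
    squareFree : SquareFree n
    squareFree zero            (divides q eq) = contradiction (trans eq (*-zeroʳ q)) n≢0
    squareFree 1               _              = refl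
    squareFree k@(suc (suc _)) kk∣n           =
      contradiction (k , s≤s (≤-trans (m≤m*n k k) (∣⇒≤ kk∣n)) , s≤s (s≤s z≤n) , kk∣n) none

  SquareFreeDecomposition : ℕ → Set
  SquareFreeDecomposition n = ∃₂ λ d y → SquareFree d × n ≡ d * (y * y)

  squareFree-decomposition : ∀ n → n ≢ 0 → SquareFreeDecomposition n
  squareFree-decomposition = <-rec _ decompose
    where
    decompose : ∀ n → (∀ {m} → m < n → m ≢ 0 → SquareFreeDecomposition m) →
                n ≢ 0 → SquareFreeDecomposition n
    decompose n rec n≢0 with squareFree⊎square-factor n n≢0
    ... | inj₁ sf = n , 1 , sf , sym (*-identityʳ n)
    ... | inj₂ (k , 1<k , divides m refl) with rec (m<m*n m (k * k) 1<k*k) m≢0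
      where
      m≢0 : m ≢ 0
      m≢0 refl = n≢0 refl
      instance
        _ = ≢-nonZero (m<n⇒n≢0 1<k)
        _ = ≢-nonZero m≢0
      1<k*k : 1 < k * k
      1<k*k = <-≤-trans 1<k (m≤m*n k k)
    ... | d , y , sf , refl = d , y * k , sf , regroup d y k
      where
      regroup : ∀ d y k → d * (y * y) * (k * k) ≡ d * (y * k * (y * k))
      regroup = solve-∀

  d*y²*m-square⇒m≡d*square : ∀ {d y m} → SquareFree d → y ≢ 0 →
                             IsSquare (d * (y * y) * m) → ∃ λ u → m ≡ d * (u * u)
  d*y²*m-square⇒m≡d*square {d} {y} {m} sf y≢0 (t , eq) =
    d*m-square⇒m≡d*square sf (k*k*m-square⇒m-square y (d * m) y≢0 (t , trans (regroup y d m) eq))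
    where
    regroup : ∀ y d m → y * y * (d * m) ≡ d * (y * y) * m
    regroup = solve-∀

  square-product⇒common-squareFree-part : ∀ m n → m ≢ 0 → IsSquare (m * n) →
    ∃ λ d → SquareFree d × (∃ λ y → m ≡ d * (y * y)) × (∃ λ u → n ≡ d * (u * u))
  square-product⇒common-squareFree-part m n m≢0 mn-square with squareFree-decomposition m m≢0
  ... | d , y , sf , refl = d , sf , (y , refl) , d*y²*m-square⇒m≡d*square sf y≢0 mn-square
    where
    y≢0 : y ≢ 0
    y≢0 refl = m≢0 (*-zeroʳ d)

  suc[n*n]≡d*[y*y]⇒1<d : ∀ {n d y} → SquareFree d → n ≢ 0 → suc (n * n) ≡ d * (y * y) → 1 < d
  suc[n*n]≡d*[y*y]⇒1<d {n} {d} {y} sf n≢0 eq = ≤∧≢⇒< (n≢0⇒n>0 (squareFree⇒≢0 sf)) 1≢d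
    where
    1≢d : 1 ≢ d
    1≢d refl = n≢0 (suc[n*n]-square⇒n≡0 n (y , trans eq (*-identityˡ (y * y))))

module StarZ-Properties where

  import Data.Nat as ℕ
  import Data.Nat.Properties as ℕ
  open import Data.Integer
  open import Data.Integer.Properties
  open import Data.Integer.Tactic.RingSolver using (solve-∀)
  open import Data.Product using (_,_)
  open import Data.Sum using ([_,_]′)
  open import Relation.Nullary using (¬_; contradiction)
  open import Relation.Binary.PropositionalEquality
  open Squares using (IsSquare)

  starQuotient : ℤ → ℤ → ℤ → ℤ
  starQuotient a b c = (a + b) * (+ 1 - c * c) + (c + c) * (a * b - + 1)

  starZ-factorisation : ∀ a b c →
    ((a - c) * (a - c)) * (b * b + + 1) - ((b - c) * (b - c)) * (a * a + + 1) ≡ (a - b) * starQuotient a b c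
  starZ-factorisation = identity
    where
    identity : ∀ a b c → ((a - c) * (a - c)) * (b * b + + 1) - ((b - c) * (b - c)) * (a * a + + 1)
             ≡ (a - b) * ((a + b) * (+ 1 - c * c) + (c + c) * (a * b - + 1))
    identity = solve-∀

  starQuotient-discriminant : ∀ a b c →
    (a * a + + 1) * (b * b + + 1)
      ≡ ((a + b) * c - (a * b - + 1)) * ((a + b) * c - (a * b - + 1)) + (a + b) * starQuotient a b c
  starQuotient-discriminant = identity
    where
    identity : ∀ a b c → (a * a + + 1) * (b * b + + 1)
             ≡ ((a + b) * c - (a * b - + 1)) * ((a + b) * c - (a * b - + 1))
               + (a + b) * ((a + b) * (+ 1 - c * c) + (c + c) * (a * b - + 1))
    identity = solve-∀

  nontrivial-starZ⇒starQuotient≡0 : ∀ a b c → StarZ a b c → ¬ Trivial a b c →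
                                    starQuotient a b c ≡ 0ℤ
  nontrivial-starZ⇒starQuotient≡0 a b c star nontrivial =
    [ (λ a-b≡0 → contradiction (cong ∣_∣ (i-j≡0⇒i≡j a b a-b≡0)) nontrivial) , (λ q≡0 → q≡0) ]′
      (i*j≡0⇒i≡0∨j≡0 (a - b) (trans (sym (starZ-factorisation a b c)) (i≡j⇒i-j≡0 star)))

  i*i≡+∣i∣*∣i∣ : ∀ i → i * i ≡ + (∣ i ∣ ℕ.* ∣ i ∣)
  i*i≡+∣i∣*∣i∣ (+ 0)     = refl
  i*i≡+∣i∣*∣i∣ +[1+ n ]  = refl
  i*i≡+∣i∣*∣i∣ -[1+ n ]  = refl

  ∣i*i+1∣≡suc[∣i∣*∣i∣] : ∀ i → ∣ i * i + + 1 ∣ ≡ ℕ.suc (∣ i ∣ ℕ.* ∣ i ∣)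
  ∣i*i+1∣≡suc[∣i∣*∣i∣] i = trans (cong (λ j → ∣ j + + 1 ∣) (i*i≡+∣i∣*∣i∣ i)) (ℕ.+-comm (∣ i ∣ ℕ.* ∣ i ∣) 1)

  nontrivial-starZ⇒square : ∀ a b c → StarZ a b c → ¬ Trivial a b c →
                            IsSquare (ℕ.suc (∣ a ∣ ℕ.* ∣ a ∣) ℕ.* ℕ.suc (∣ b ∣ ℕ.* ∣ b ∣))
  nontrivial-starZ⇒square a b c star nontrivial = ∣ t ∣ , (begin
    ℕ.suc (∣ a ∣ ℕ.* ∣ a ∣) ℕ.* ℕ.suc (∣ b ∣ ℕ.* ∣ b ∣)
      ≡⟨ cong₂ ℕ._*_ (∣i*i+1∣≡suc[∣i∣*∣i∣] a) (∣i*i+1∣≡suc[∣i∣*∣i∣] b) ⟨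
    ∣ a * a + + 1 ∣ ℕ.* ∣ b * b + + 1 ∣
      ≡⟨ abs-* (a * a + + 1) (b * b + + 1) ⟨
    ∣ (a * a + + 1) * (b * b + + 1) ∣
      ≡⟨ cong ∣_∣ (starQuotient-discriminant a b c) ⟩
    ∣ t * t + (a + b) * starQuotient a b c ∣
      ≡⟨ cong (λ q → ∣ t * t + (a + b) * q ∣) (nontrivial-starZ⇒starQuotient≡0 a b c star nontrivial) ⟩
    ∣ t * t + (a + b) * 0ℤ ∣
      ≡⟨ cong ∣_∣ (trans (cong (λ x → t * t + x) (*-zeroʳ (a + b))) (+-identityʳ (t * t))) ⟩
    ∣ t * t ∣
      ≡⟨ abs-* t t ⟩
    ∣ t ∣ ℕ.* ∣ t ∣
      ∎)
    where
    open ≡-Reasoning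
    t : ℤ
    t = (a + b) * c - (a * b - + 1)

  suc[∣x∣*∣x∣]≡d*[y*y]⇒pellXComponent : ∀ d x y →
    ℕ.suc (∣ x ∣ ℕ.* ∣ x ∣) ≡ d ℕ.* (y ℕ.* y) → PellXComponent d x
  suc[∣x∣*∣x∣]≡d*[y*y]⇒pellXComponent d x y eq = + y , (begin
    x * x - + d * (+ y * + y)
      ≡⟨ cong₂ _-_ (i*i≡+∣i∣*∣i∣ x) (sym (trans (pos-* d (y ℕ.* y)) (cong (λ z → + d * z) (pos-* y y)))) ⟩
    + n - + (d ℕ.* (y ℕ.* y))
      ≡⟨ cong (λ m → + n - + m) eq ⟨
    + n - (+ 1 + + n)
      ≡⟨ m-[1+m]≡-1 (+ n) ⟩
    - (+ 1)
      ∎)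
    where
    open ≡-Reasoning
    n : ℕ
    n = ∣ x ∣ ℕ.* ∣ x ∣
    m-[1+m]≡-1 : ∀ m → m - (+ 1 + m) ≡ - (+ 1)
    m-[1+m]≡-1 = solve-∀

import Data.Nat.Properties as ℕ
import Data.Integer.Properties as ℤ
open import Relation.Binary.PropositionalEquality using (_≢_; refl; sym; trans)
open Squares
open StarZ-Properties

starZ-left-zero⇒trivial : ∀ b c → StarZ (+ 0) b c → Trivial (+ 0) b c
starZ-left-zero⇒trivial b c star = decidable-stable (0 ℕ.≟ ℤ.∣ b ∣) λ nontrivial →
  let t , B≡tt = nontrivial-starZ⇒square (+ 0) b c star nontrivial
  in nontrivial (sym (suc[n*n]-square⇒n≡0 ℤ.∣ b ∣ (t , trans (sym (ℕ.*-identityˡ _)) B≡tt)))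

starZ-zero⇒trivial : ∀ a b c → StarZ a b c → a ≡ + 0 ⊎ b ≡ + 0 → Trivial a b c
starZ-zero⇒trivial _ b c star (inj₁ refl) = starZ-left-zero⇒trivial b c star
starZ-zero⇒trivial a _ c star (inj₂ refl) = sym (starZ-left-zero⇒trivial a c (sym star))

nontrivial-starZ⇒pell : ∀ a b c → StarZ a b c → ¬ Trivial a b c →
                        ∃ λ d → 1 ℕ.< d × SquareFree d × PellXComponent d a × PellXComponent d b
nontrivial-starZ⇒pell a b c star nontrivial =
  let d , sf , (y , A≡dyy) , (u , B≡duu) =
        square-product⇒common-squareFree-part _ _ (λ ()) (nontrivial-starZ⇒square a b c star nontrivial)
  in d , suc[n*n]≡d*[y*y]⇒1<d {y = y} sf ∣a∣≢0 A≡dyy , sf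
       , suc[∣x∣*∣x∣]≡d*[y*y]⇒pellXComponent d a y A≡dyy
       , suc[∣x∣*∣x∣]≡d*[y*y]⇒pellXComponent d b u B≡duu
  where
  ∣a∣≢0 : ℤ.∣ a ∣ ≢ 0
  ∣a∣≢0 ∣a∣≡0 = nontrivial (starZ-zero⇒trivial a b c star (inj₁ (ℤ.∣i∣≡0⇒i≡0 ∣a∣≡0)))

proposition1p4 : ∀ {c ℓ : Level} →
  (∀ (R : CommutativeRing c ℓ) →
     let open CommutativeRing R in
     ∀ (a₁ b₁ c₁ : Carrier) → StarR R a₁ b₁ c₁ →
       (∀ (c₁⁻¹ : Carrier) → c₁ * c₁⁻¹ ≈ 1# → StarR R a₁ b₁ (- c₁⁻¹))
       × StarR R (- a₁) (- b₁) (- c₁)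
       × StarR R b₁ a₁ c₁)
  × (∀ (a b c : ℤ) → StarZ a b c → (a ≡ + 0 ⊎ b ≡ + 0) → Trivial a b c)
  × (∀ (a₁ b₁ c₁ : ℤ) → StarZ a₁ b₁ c₁ → ¬ Trivial a₁ b₁ c₁ →
       ∃ λ (d : ℕ) → 1 ℕ.< d × SquareFree d
         × PellXComponent d a₁ × PellXComponent d b₁)
proposition1p4 = (λ R _ _ _ star → let open StarR-Properties R in
                   (λ _ → starR-inverse star) , starR-negate star , starR-swap star)
               , starZ-zero⇒trivial
               , nontrivial-starZ⇒pell
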